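{- There exists a class $\mathcal{P}$ of finite posets which has bounded width but does not have bounded clique-width.
   Context: A poset $(P,\le)$ is viewed as a directed graph with vertex set $P$ and edge relation $\le$; its clique-width is the clique-width of this digraph. The width of a poset is the maximum size of an antichain (set of pairwise incomparable elements). A class has bounded width (clique-width) if some constant bounds the width (clique-width) of all its members. -}

module Defs where

open import Level using (0ℓ)
open import Data.Nat using (ℕ; zero; suc; _+_; _≤_)
open import Data.Fin using (Fin; splitAt; _≟_)
open import Data.Sum using (_⊎_; inj₁; inj₂)
open import Data.Product using (Σ; _×_; _,_)
open import Data.Empty using (⊥)
open import Data.List using (List; length)
open import Data.List.Relation.Unary.AllPairs using (AllPairs)
open import Relation.Nullary using (¬_; yes; no)
open import Relation.Binary.PropositionalEquality using (_≡_; _≢_)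
open import Relation.Binary.Definitions using (Decidable)
open import Relation.Binary.Structures using (IsPartialOrder)
open import Function.Bundles using (_↔_; _⇔_; Inverse)

record FinPoset : Set₁ where
  field
    size           : ℕ
    _≼_            : Fin size → Fin size → Set
    isPartialOrder : IsPartialOrder _≡_ _≼_
    decide         : Decidable _≼_

open FinPoset public

Incomparable : (P : FinPoset) → Fin (size P) → Fin (size P) → Set
Incomparable P x y = x ≢ y × ¬ (_≼_ P x y) × ¬ (_≼_ P y x)

IsAntichain : (P : FinPoset) → List (Fin (size P)) → Set
IsAntichain P xs = AllPairs (Incomparable P) xs

WidthAtMost : ℕ → FinPoset → Set
WidthAtMost w P = (xs : List (Fin (size P))) → IsAntichain P xs → length xs ≤ w

-- Clique-width of (finite) directed graphs, via k-expressions.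

data Expr (k : ℕ) : Set where
  empty   : Expr k
  vertex  : Fin k → Expr k
  _⊕_     : Expr k → Expr k → Expr k
  relabel : Fin k → Fin k → Expr k → Expr k
  arcs    : (i j : Fin k) → i ≢ j → Expr k → Expr k

∣_∣ₑ : ∀ {k} → Expr k → ℕ
∣ empty ∣ₑ = 0
∣ vertex i ∣ₑ = 1
∣ e₁ ⊕ e₂ ∣ₑ = ∣ e₁ ∣ₑ + ∣ e₂ ∣ₑ
∣ relabel i j e ∣ₑ = ∣ e ∣ₑ
∣ arcs i j _ e ∣ₑ = ∣ e ∣ₑ

label : ∀ {k} (e : Expr k) → Fin ∣ e ∣ₑ → Fin k
label (vertex i) _ = i
label (e₁ ⊕ e₂) x with splitAt ∣ e₁ ∣ₑ x
... | inj₁ x₁ = label e₁ x₁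
... | inj₂ x₂ = label e₂ x₂
label (relabel i j e) x with label e x ≟ i
... | yes _ = j
... | no  _ = label e x
label (arcs i j _ e) x = label e x

Arc : ∀ {k} (e : Expr k) → Fin ∣ e ∣ₑ → Fin ∣ e ∣ₑ → Set
Arc empty () _
Arc (vertex i) _ _ = ⊥
Arc (e₁ ⊕ e₂) x y = unionArc (splitAt ∣ e₁ ∣ₑ x) (splitAt ∣ e₁ ∣ₑ y)
  where
  unionArc : Fin ∣ e₁ ∣ₑ ⊎ Fin ∣ e₂ ∣ₑ → Fin ∣ e₁ ∣ₑ ⊎ Fin ∣ e₂ ∣ₑ → Set
  unionArc (inj₁ a) (inj₁ b) = Arc e₁ a b
  unionArc (inj₂ a) (inj₂ b) = Arc e₂ a b
  unionArc _ _ = ⊥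
Arc (relabel i j e) x y = Arc e x y
Arc (arcs i j _ e) x y = Arc e x y ⊎ (label e x ≡ i × label e y ≡ j)

CliqueWidthAtMost : ℕ → (n : ℕ) → (Fin n → Fin n → Set) → Set
CliqueWidthAtMost k n E =
  Σ (Expr k) λ e → Σ (Fin n ↔ Fin ∣ e ∣ₑ) λ f →
    ∀ x y → E x y ⇔ Arc e (Inverse.to f x) (Inverse.to f y)

-- The digraph of a poset: arcs x → y for x ≤ y (loops x ≤ x are dropped,
-- as clique-width is defined for loopless digraphs).
PosetArc : (P : FinPoset) → Fin (size P) → Fin (size P) → Set
PosetArc P x y = _≼_ P x y × x ≢ y

PosetCliqueWidthAtMost : ℕ → FinPoset → Set
PosetCliqueWidthAtMost k P = CliqueWidthAtMost k (size P) (PosetArc P)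

Class : Set₂
Class = FinPoset → Set₁

BoundedWidth : Class → Set₁
BoundedWidth 𝒫 = Σ ℕ λ w → ∀ P → 𝒫 P → WidthAtMost w P

BoundedCliqueWidth : Class → Set₁
BoundedCliqueWidth 𝒫 = Σ ℕ λ k → ∀ P → 𝒫 P → PosetCliqueWidthAtMost k P

-- For N = 2T + 1 let P_N consist of three chains A, B, C of length N with
-- A_i ≤ B_j iff i ≤ j,  B_j ≤ C_l iff j ≤ l,  A_i ≤ C_l iff i ≤ 2l + 1.
-- Being covered by three chains, P_N has width at most 3 (chainCover-width).
--
-- Clique-width: a k-expression yields "twin cuts", vertex sets with a
-- k-colouring whose colour classes look alike from outside; descending the
-- expression tree gives one containing between T/2 and T of the 2T + 1
-- elements of C (cliqueWidth-balancedCut).  For a twin cut of P_N let G s count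
-- the inside elements among C_0 .. C_(s-1).  Comparing C with B and A, whose
-- mismatches must be told apart by colours, gives the doubling inequalities
-- G (2s) ≤ 2 G s + 4k and 2 G s ≤ G (2s) + 4k.  On the scales t i = 2^i 16(k+1)
-- some window [t i, 2 t i), i ≤ 2k, is entirely inside or entirely outside the
-- cut, as otherwise k + 1 alternations along C would need k + 1 colours
-- (homogeneousWindow); iterating the doubling inequalities from that window
-- makes G N too small or too large (noBalancedCut).  So with T = t (2k) the
-- poset P_N has clique-width > k, and the P_N for k ∈ ℕ form the class.

module Submission where

open import Defs
open import Data.Nat using (ℕ; zero; suc; _+_; _*_; _^_; _≤_; _<_; z≤n; s≤s; _≤?_; _<?_)
open import Data.Nat.Properties
open import Data.Nat.Solver using (module +-*-Solver)
open import Data.Fin using (Fin; zero; suc; toℕ; splitAt; _↑ˡ_; _↑ʳ_)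
  renaming (_<_ to _<ᶠ_; _≟_ to _≟ᶠ_)
open import Data.Fin.Properties using (splitAt-↑ˡ; splitAt-↑ʳ; splitAt⁻¹-↑ˡ; splitAt⁻¹-↑ʳ; toℕ-injective; toℕ<n; pigeonhole)
open import Data.Bool using (Bool; true; false; if_then_else_; _∧_; not)
open import Data.Sum using (_⊎_; inj₁; inj₂; [_,_]′)
open import Data.Product using (Σ; ∃; _×_; _,_; proj₁; proj₂)
open import Data.Empty using (⊥; ⊥-elim)
open import Data.List using (List; _∷_; length; lookup)
open import Data.List.Relation.Unary.All as All using ()
open import Data.List.Relation.Unary.AllPairs using (AllPairs; _∷_)
open import Data.List.Membership.Propositional.Properties using (∈-lookup)
open import Relation.Nullary using (¬_; yes; no; Dec)
open import Relation.Binary.PropositionalEquality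
open import Relation.Binary.Structures using (IsPartialOrder)
open import Function using (_∘′_; id)
open import Function.Bundles using (Inverse; Equivalence)
open import Algebra.Properties.CommutativeMonoid.Sum +-0-commutativeMonoid
  using (sum; sum-cong-≗; sum-replicate-zero; ∑-permute)

allPairs-lookup : ∀ {A : Set} {R : A → A → Set} {xs : List A} → AllPairs R xs →
                  ∀ {i j} → i <ᶠ j → R (lookup xs i) (lookup xs j)
allPairs-lookup (rx ∷ _)  {zero}  {suc j} _          = All.lookup rx (∈-lookup j)
allPairs-lookup (_ ∷ rxs) {suc i} {suc j} (s≤s i<j) = allPairs-lookup rxs i<j

-- The easy half of Dilworth's theorem: a poset covered by w chains has
-- width at most w, since by pigeonhole a longer antichain meets some chain twice.
chainCover-width : (P : FinPoset) (w : ℕ) (chain : Fin (size P) → Fin w) →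
                   (∀ x y → chain x ≡ chain y → _≼_ P x y ⊎ _≼_ P y x) → WidthAtMost w P
chainCover-width P w chain comparable xs antichain with length xs ≤? w
... | yes fits = fits
... | no tooLong with pigeonhole (≰⇒> tooLong) (λ i → chain (lookup xs i))
...   | i , j , i<j , sameChain =
  ⊥-elim (notBoth (allPairs-lookup antichain i<j) (comparable _ _ sameChain))
  where
  notBoth : ∀ {x y} → Incomparable P x y → _≼_ P x y ⊎ _≼_ P y x → ⊥
  notBoth (_ , x⋠y , _) (inj₁ x≼y) = x⋠y x≼y
  notBoth (_ , _ , y⋠x) (inj₂ y≼x) = y⋠x y≼x

OutTwins : ∀ {k} {V : Set} → (V → V → Set) → (V → Bool) → (V → Fin k) → Set
OutTwins E inside colour = ∀ x y z → inside x ≡ true → inside y ≡ true →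
  colour x ≡ colour y → inside z ≡ false → E x z → E y z

record TwinCut (k : ℕ) {V : Set} (E : V → V → Set) : Set where
  field
    inside  : V → Bool
    colour  : V → Fin k
    twinOut : OutTwins E inside colour
    twinIn  : OutTwins (λ x y → E y x) inside colour
open TwinCut

-- In a k-expression, a twin cut whose colour classes also have constant label.
-- This stronger invariant is preserved by relabelling and by adding arcs.
record LabelCut {k} (e : Expr k) : Set where
  field
    cut       : TwinCut k (Arc e)
    sameLabel : ∀ x y → inside cut x ≡ true → inside cut y ≡ true →
                colour cut x ≡ colour cut y → label e x ≡ label e y
open LabelCut

weightIn : ∀ {n} → (Fin n → Bool) → (Fin n → ℕ) → ℕ
weightIn S w = sum (λ x → if S x then w x else 0)

module _ {k : ℕ} where

  fullCut : (e : Expr k) → LabelCut e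
  fullCut e = record
    { cut = record { inside = λ _ → true ; colour = label e
                   ; twinOut = λ { _ _ _ _ _ _ () _ } ; twinIn = λ { _ _ _ _ _ _ () _ } }
    ; sameLabel = λ _ _ _ _ sameColour → sameColour }

  relabel-resp : ∀ i j (e : Expr k) x y → label e x ≡ label e y →
                 label (relabel i j e) x ≡ label (relabel i j e) y
  relabel-resp i j e x y eq with label e x ≟ᶠ i | label e y ≟ᶠ i
  ... | yes _   | yes _   = refl
  ... | yes x≡i | no  y≢i = ⊥-elim (y≢i (trans (sym eq) x≡i))
  ... | no  x≢i | yes y≡i = ⊥-elim (x≢i (trans eq y≡i))
  ... | no  _   | no  _   = eq

  relabelCut : ∀ i j (e : Expr k) → LabelCut e → LabelCut (relabel i j e)
  relabelCut i j e C = record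
    { cut = cut C
    ; sameLabel = λ x y sx sy same → relabel-resp i j e x y (sameLabel C x y sx sy same) }

  -- New arcs join label classes, and the colours of the cut refine the labels.
  arcsCut : ∀ i j (i≢j : i ≢ j) (e : Expr k) → LabelCut e → LabelCut (arcs i j i≢j e)
  arcsCut i j i≢j e C = record
    { cut = record { inside = inside (cut C) ; colour = colour (cut C)
                   ; twinOut = out ; twinIn = inn }
    ; sameLabel = sameLabel C }
    where
    out : OutTwins (Arc (arcs i j i≢j e)) (inside (cut C)) (colour (cut C))
    out x y z sx sy same sz (inj₁ arc)       = inj₁ (twinOut (cut C) x y z sx sy same sz arc)
    out x y z sx sy same sz (inj₂ (lx , lz)) = inj₂ (trans (sym (sameLabel C x y sx sy same)) lx , lz)
    inn : OutTwins (λ x y → Arc (arcs i j i≢j e) y x) (inside (cut C)) (colour (cut C))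
    inn x y z sx sy same sz (inj₁ arc)       = inj₁ (twinIn (cut C) x y z sx sy same sz arc)
    inn x y z sx sy same sz (inj₂ (lz , lx)) = inj₂ (lz , trans (sym (sameLabel C x y sx sy same)) lx)

module _ {k : ℕ} (e₁ e₂ : Expr k) where
  private
    m = ∣ e₁ ∣ₑ

  leftCut : LabelCut e₁ → LabelCut (e₁ ⊕ e₂)
  leftCut C = record
    { cut = record { inside = S ; colour = c ; twinOut = out ; twinIn = inn }
    ; sameLabel = same }
    where
    S : Fin ∣ e₁ ⊕ e₂ ∣ₑ → Bool
    S x = [ inside (cut C) , (λ _ → false) ]′ (splitAt m x)
    c : Fin ∣ e₁ ⊕ e₂ ∣ₑ → Fin k
    c x = [ colour (cut C) , label e₂ ]′ (splitAt m x)
    same : ∀ x y → S x ≡ true → S y ≡ true → c x ≡ c y → label (e₁ ⊕ e₂) x ≡ label (e₁ ⊕ e₂) y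
    same x y sx sy cxy with splitAt m x | splitAt m y
    same x y sx sy cxy | inj₁ a | inj₁ b = sameLabel C a b sx sy cxy
    same x y () sy cxy | inj₂ _ | _
    same x y sx () cxy | inj₁ _ | inj₂ _
    out : OutTwins (Arc (e₁ ⊕ e₂)) S c
    out x y z sx sy cxy sz arc with splitAt m x | splitAt m y | splitAt m z
    out x y z sx sy cxy sz arc | inj₁ a | inj₁ b | inj₁ d = twinOut (cut C) a b d sx sy cxy sz arc
    out x y z sx sy cxy sz arc | inj₁ _ | inj₁ _ | inj₂ _ = arc
    out x y z () sy cxy sz arc | inj₂ _ | _      | _
    out x y z sx () cxy sz arc | inj₁ _ | inj₂ _ | _
    inn : OutTwins (λ x y → Arc (e₁ ⊕ e₂) y x) S c
    inn x y z sx sy cxy sz arc with splitAt m x | splitAt m y | splitAt m z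
    inn x y z sx sy cxy sz arc | inj₁ a | inj₁ b | inj₁ d = twinIn (cut C) a b d sx sy cxy sz arc
    inn x y z sx sy cxy sz arc | inj₁ _ | inj₁ _ | inj₂ _ = arc
    inn x y z () sy cxy sz arc | inj₂ _ | _      | _
    inn x y z sx () cxy sz arc | inj₁ _ | inj₂ _ | _

  rightCut : LabelCut e₂ → LabelCut (e₁ ⊕ e₂)
  rightCut C = record
    { cut = record { inside = S ; colour = c ; twinOut = out ; twinIn = inn }
    ; sameLabel = same }
    where
    S : Fin ∣ e₁ ⊕ e₂ ∣ₑ → Bool
    S x = [ (λ _ → false) , inside (cut C) ]′ (splitAt m x)
    c : Fin ∣ e₁ ⊕ e₂ ∣ₑ → Fin k
    c x = [ label e₁ , colour (cut C) ]′ (splitAt m x)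
    same : ∀ x y → S x ≡ true → S y ≡ true → c x ≡ c y → label (e₁ ⊕ e₂) x ≡ label (e₁ ⊕ e₂) y
    same x y sx sy cxy with splitAt m x | splitAt m y
    same x y sx sy cxy | inj₂ a | inj₂ b = sameLabel C a b sx sy cxy
    same x y () sy cxy | inj₁ _ | _
    same x y sx () cxy | inj₂ _ | inj₁ _
    out : OutTwins (Arc (e₁ ⊕ e₂)) S c
    out x y z sx sy cxy sz arc with splitAt m x | splitAt m y | splitAt m z
    out x y z sx sy cxy sz arc | inj₂ a | inj₂ b | inj₂ d = twinOut (cut C) a b d sx sy cxy sz arc
    out x y z sx sy cxy sz arc | inj₂ _ | inj₂ _ | inj₁ _ = arc
    out x y z () sy cxy sz arc | inj₁ _ | _      | _
    out x y z sx () cxy sz arc | inj₂ _ | inj₁ _ | _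
    inn : OutTwins (λ x y → Arc (e₁ ⊕ e₂) y x) S c
    inn x y z sx sy cxy sz arc with splitAt m x | splitAt m y | splitAt m z
    inn x y z sx sy cxy sz arc | inj₂ a | inj₂ b | inj₂ d = twinIn (cut C) a b d sx sy cxy sz arc
    inn x y z sx sy cxy sz arc | inj₂ _ | inj₂ _ | inj₁ _ = arc
    inn x y z () sy cxy sz arc | inj₁ _ | _      | _
    inn x y z sx () cxy sz arc | inj₂ _ | inj₁ _ | _

sum-↑ : ∀ m n (f : Fin (m + n) → ℕ) → sum f ≡ sum (λ i → f (i ↑ˡ n)) + sum (λ i → f (m ↑ʳ i))
sum-↑ zero    n f = refl
sum-↑ (suc m) n f = trans (cong (f zero +_) (sum-↑ m n (λ i → f (suc i)))) (sym (+-assoc (f zero) _ _))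

module _ {k : ℕ} (e₁ e₂ : Expr k) (w : Fin ∣ e₁ ⊕ e₂ ∣ₑ → ℕ) where
  private
    m = ∣ e₁ ∣ₑ
    n = ∣ e₂ ∣ₑ

  wˡ : Fin m → ℕ
  wˡ i = w (i ↑ˡ n)

  wʳ : Fin n → ℕ
  wʳ i = w (m ↑ʳ i)

  leftCut-weight : (C : LabelCut e₁) →
    weightIn (inside (cut (leftCut e₁ e₂ C))) w ≡ weightIn (inside (cut C)) wˡ
  leftCut-weight C =
    trans (sum-↑ m n _)
      (trans (cong₂ _+_ (sum-cong-≗ onLeft) (trans (sum-cong-≗ onRight) (sum-replicate-zero n)))
             (+-identityʳ _))
    where
    S : Fin (m + n) → Bool
    S = inside (cut (leftCut e₁ e₂ C))
    onLeft : ∀ i → (if S (i ↑ˡ n) then wˡ i else 0) ≡ (if inside (cut C) i then wˡ i else 0)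
    onLeft i rewrite splitAt-↑ˡ m i n = refl
    onRight : ∀ i → (if S (m ↑ʳ i) then wʳ i else 0) ≡ 0
    onRight i rewrite splitAt-↑ʳ m n i = refl

  rightCut-weight : (C : LabelCut e₂) →
    weightIn (inside (cut (rightCut e₁ e₂ C))) w ≡ weightIn (inside (cut C)) wʳ
  rightCut-weight C =
    trans (sum-↑ m n _)
      (cong₂ _+_ (trans (sum-cong-≗ onLeft) (sum-replicate-zero m)) (sum-cong-≗ onRight))
    where
    S : Fin (m + n) → Bool
    S = inside (cut (rightCut e₁ e₂ C))
    onLeft : ∀ i → (if S (i ↑ˡ n) then wˡ i else 0) ≡ 0
    onLeft i rewrite splitAt-↑ˡ m i n = refl
    onRight : ∀ i → (if S (m ↑ʳ i) then wʳ i else 0) ≡ (if inside (cut C) i then wʳ i else 0)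
    onRight i rewrite splitAt-↑ʳ m n i = refl

Balanced : ℕ → ℕ → Set
Balanced T v = T < 2 * v × v ≤ T

larger-half : ∀ T a b → T < a + b → b ≤ a → T < 2 * a
larger-half T a b T<a+b b≤a = <-≤-trans T<a+b (begin
  a + b       ≤⟨ +-monoʳ-≤ a b≤a ⟩
  a + a       ≡⟨ cong (a +_) (sym (+-identityʳ a)) ⟩
  2 * a       ∎)
  where open ≤-Reasoning

-- Descend into an
-- operand of a union while it still weighs more than T; once both operands
-- weigh at most T, the heavier one, taken entirely, is balanced.
balancedCut : ∀ {k} (e : Expr k) (w : Fin ∣ e ∣ₑ → ℕ) → (∀ x → w x ≤ 1) →
              ∀ T → 1 ≤ T → T < sum w →
              Σ (LabelCut e) λ C → Balanced T (weightIn (inside (cut C)) w)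
balancedCut empty w w≤1 T 1≤T ()
balancedCut (vertex i) w w≤1 T 1≤T T<w =
  ⊥-elim (<⇒≱ T<w (≤-trans (≤-trans (≤-reflexive (+-identityʳ (w zero))) (w≤1 zero)) 1≤T))
balancedCut (relabel i j e) w w≤1 T 1≤T T<w with balancedCut e w w≤1 T 1≤T T<w
... | C , balanced = relabelCut i j e C , balanced
balancedCut (arcs i j i≢j e) w w≤1 T 1≤T T<w with balancedCut e w w≤1 T 1≤T T<w
... | C , balanced = arcsCut i j i≢j e C , balanced
balancedCut (e₁ ⊕ e₂) w w≤1 T 1≤T T<w
  with T <? sum (wˡ e₁ e₂ w) | T <? sum (wʳ e₁ e₂ w)
... | yes T<left | _ with balancedCut e₁ (wˡ e₁ e₂ w) (λ _ → w≤1 _) T 1≤T T<left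
...   | C , balanced =
  leftCut e₁ e₂ C , subst (Balanced T) (sym (leftCut-weight e₁ e₂ w C)) balanced
balancedCut (e₁ ⊕ e₂) w w≤1 T 1≤T T<w | no _ | yes T<right
  with balancedCut e₂ (wʳ e₁ e₂ w) (λ _ → w≤1 _) T 1≤T T<right
...   | C , balanced =
  rightCut e₁ e₂ C , subst (Balanced T) (sym (rightCut-weight e₁ e₂ w C)) balanced
balancedCut (e₁ ⊕ e₂) w w≤1 T 1≤T T<w | no T≮left | no T≮right
  with sum (wʳ e₁ e₂ w) ≤? sum (wˡ e₁ e₂ w)
... | yes right≤left =
  leftCut e₁ e₂ (fullCut e₁) ,
  subst (Balanced T) (sym (leftCut-weight e₁ e₂ w (fullCut e₁)))
    (larger-half T _ _ T<left+right right≤left , ≮⇒≥ T≮left)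
  where
  T<left+right : T < sum (wˡ e₁ e₂ w) + sum (wʳ e₁ e₂ w)
  T<left+right = subst (T <_) (sum-↑ ∣ e₁ ∣ₑ ∣ e₂ ∣ₑ w) T<w
... | no right≰left =
  rightCut e₁ e₂ (fullCut e₂) ,
  subst (Balanced T) (sym (rightCut-weight e₁ e₂ w (fullCut e₂)))
    (larger-half T _ _ T<right+left (<⇒≤ (≰⇒> right≰left)) , ≮⇒≥ T≮right)
  where
  T<right+left : T < sum (wʳ e₁ e₂ w) + sum (wˡ e₁ e₂ w)
  T<right+left = subst (T <_) (trans (sum-↑ ∣ e₁ ∣ₑ ∣ e₂ ∣ₑ w) (+-comm (sum (wˡ e₁ e₂ w)) _)) T<w

-- It is the
-- balanced cut of a k-expression, pulled back along the isomorphism.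
cliqueWidth-balancedCut : ∀ {k n} {E : Fin n → Fin n → Set} → CliqueWidthAtMost k n E →
  (w : Fin n → ℕ) → (∀ x → w x ≤ 1) → ∀ T → 1 ≤ T → T < sum w →
  Σ (TwinCut k E) λ C → Balanced T (weightIn (inside C) w)
cliqueWidth-balancedCut {k} {n} {E} (e , f , E⇔Arc) w w≤1 T 1≤T T<w =
  pullback , subst (Balanced T) (sym (weight-transfer (inside (cut C)))) balanced
  where
  to : Fin n → Fin ∣ e ∣ₑ
  to = Inverse.to f
  from : Fin ∣ e ∣ₑ → Fin n
  from = Inverse.from f
  wₑ : Fin ∣ e ∣ₑ → ℕ
  wₑ v = w (from v)

  weight-transfer : (S : Fin ∣ e ∣ₑ → Bool) → weightIn (λ x → S (to x)) w ≡ weightIn S wₑ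
  weight-transfer S = sym (trans (∑-permute (λ v → if S v then wₑ v else 0) f)
    (sum-cong-≗ λ x → cong (λ y → if S (to x) then w y else 0) (Inverse.strictlyInverseʳ f x)))

  found : Σ (LabelCut e) λ C → Balanced T (weightIn (inside (cut C)) wₑ)
  found = balancedCut e wₑ (λ v → w≤1 (from v)) T 1≤T (subst (T <_) (weight-transfer (λ _ → true)) T<w)
  C : LabelCut e
  C = proj₁ found
  balanced : Balanced T (weightIn (inside (cut C)) wₑ)
  balanced = proj₂ found

  pullback : TwinCut k E
  pullback = record
    { inside  = λ x → inside (cut C) (to x)
    ; colour  = λ x → colour (cut C) (to x)
    ; twinOut = λ x y z sx sy same sz xz → Equivalence.from (E⇔Arc y z)
        (twinOut (cut C) (to x) (to y) (to z) sx sy same sz (Equivalence.to (E⇔Arc x z) xz))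
    ; twinIn  = λ x y z sx sy same sz zx → Equivalence.from (E⇔Arc z y)
        (twinIn (cut C) (to x) (to y) (to z) sx sy same sz (Equivalence.to (E⇔Arc z x) zx)) }

ind : Bool → ℕ
ind true  = 1
ind false = 0

ind≤1 : ∀ b → ind b ≤ 1
ind≤1 true  = ≤-refl
ind≤1 false = z≤n

count : (ℕ → Bool) → ℕ → ℕ
count f zero    = 0
count f (suc s) = count f s + ind (f s)

count≤ : ∀ f s → count f s ≤ s
count≤ f zero    = z≤n
count≤ f (suc s) = ≤-trans (+-monoʳ-≤ (count f s) (ind≤1 (f s)))
                           (≤-trans (+-monoˡ-≤ 1 (count≤ f s)) (≤-reflexive (+-comm s 1)))

count-true : ∀ s → count (λ _ → true) s ≡ s
count-true zero    = refl
count-true (suc s) = trans (cong (_+ 1) (count-true s)) (+-comm s 1)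

count-shift : ∀ f a b → count f (a + b) ≡ count f a + count (λ u → f (a + u)) b
count-shift f a zero    rewrite +-identityʳ a = sym (+-identityʳ _)
count-shift f a (suc b) rewrite +-suc a b | count-shift f a b = +-assoc (count f a) _ _

count-even-odd : ∀ f s → count f (2 * s) ≡ count (λ l → f (2 * l)) s + count (λ l → f (suc (2 * l))) s
count-even-odd f zero    = refl
count-even-odd f (suc s) rewrite +-suc s (s + 0) | count-even-odd f s =
  solve 4 (λ a b x y → a :+ b :+ x :+ y := a :+ x :+ (b :+ y)) refl
    (count (λ l → f (2 * l)) s) (count (λ l → f (suc (2 * l))) s) (ind (f (2 * s))) (ind (f (suc (2 * s))))
  where open +-*-Solver

count-∧not : ∀ a b s → count a s ≤ count b s + count (λ l → a l ∧ not (b l)) s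
count-∧not a b zero    = z≤n
count-∧not a b (suc s) = ≤-trans (+-mono-≤ (count-∧not a b s) (step (a s) (b s)))
  (≤-reflexive (solve 4 (λ x y u v → x :+ y :+ (u :+ v) := x :+ u :+ (y :+ v)) refl
    (count b s) (count (λ l → a l ∧ not (b l)) s) (ind (b s)) (ind (a s ∧ not (b s)))))
  where
  open +-*-Solver
  step : ∀ x y → ind x ≤ ind y + ind (x ∧ not y)
  step true  true  = s≤s z≤n
  step true  false = s≤s z≤n
  step false _     = z≤n

some-true : ∀ f s → 0 < count f s → ∃ λ u → u < s × f u ≡ true
some-true f (suc s) pos with f s in fs
... | true  = s , ≤-refl , fs
... | false with some-true f s (subst (0 <_) (+-identityʳ _) pos)
...   | u , u<s , fu = u , m<n⇒m<1+n u<s , fu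

some-false : ∀ f s → count f s < s → ∃ λ u → u < s × f u ≡ false
some-false f (suc s) lt with f s in fs
... | false = s , ≤-refl , fs
... | true with some-false f s (≤-pred (subst (_< suc s) (+-comm _ 1) lt))
...   | u , u<s , fu = u , m<n⇒m<1+n u<s , fu

markedPositions : ∀ (f : ℕ → Bool) s m → m ≤ count f s →
  Σ (Fin m → ℕ) λ g → (∀ i → g i < s × f (g i) ≡ true) × (∀ i j → i <ᶠ j → g j < g i)
markedPositions f zero zero _ = (λ ()) , (λ ()) , (λ ())
markedPositions f (suc s) m m≤ with f s in fs
... | false with markedPositions f s m (subst (m ≤_) (+-identityʳ _) m≤)
...   | g , marked , decreasing = g , (λ i → m<n⇒m<1+n (proj₁ (marked i)) , proj₂ (marked i)) , decreasing
markedPositions f (suc s) zero m≤ | true = (λ ()) , (λ ()) , (λ ())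
markedPositions f (suc s) (suc m) m≤ | true
  with markedPositions f s m (≤-pred (subst (suc m ≤_) (+-comm _ 1) m≤))
... | g , marked , decreasing = g′ , marked′ , decreasing′
  where
  g′ : Fin (suc m) → ℕ
  g′ zero    = s
  g′ (suc i) = g i
  marked′ : ∀ i → g′ i < suc s × f (g′ i) ≡ true
  marked′ zero    = ≤-refl , fs
  marked′ (suc i) = m<n⇒m<1+n (proj₁ (marked i)) , proj₂ (marked i)
  decreasing′ : ∀ i j → i <ᶠ j → g′ j < g′ i
  decreasing′ zero    (suc j) _         = proj₁ (marked j)
  decreasing′ (suc i) (suc j) (s≤s i<j) = decreasing i j i<j

colours-collide : ∀ k (col : Fin (suc k) → Fin k) → ¬ (∀ i j → i <ᶠ j → col i ≢ col j)
colours-collide k col distinct with pigeonhole ≤-refl col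
... | i , j , i<j , same = distinct i j i<j same

distinctColours-count : ∀ {k} (f : ℕ → Bool) (col : ℕ → Fin k) s →
  (∀ l l' → l < l' → l' < s → f l ≡ true → f l' ≡ true → col l ≢ col l') → count f s ≤ k
distinctColours-count {k} f col s distinct with suc k ≤? count f s
... | no  few  = ≤-pred (≰⇒> few)
... | yes many with markedPositions f s (suc k) many
...   | g , marked , decreasing = ⊥-elim (colours-collide k (λ i → col (g i))
  λ i j i<j same → distinct (g j) (g i) (decreasing i j i<j) (proj₁ (marked i))
                     (proj₂ (marked j)) (proj₂ (marked i)) (sym same))

count-transfer : ∀ {k} (a b : ℕ → Bool) (col : ℕ → Fin k) s →
  (∀ l l' → l < l' → l' < s → a l ≡ true → b l ≡ false → a l' ≡ true → b l' ≡ false → col l ≢ col l') →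
  count a s ≤ count b s + k
count-transfer a b col s distinct = ≤-trans (count-∧not a b s)
  (+-monoʳ-≤ (count b s) (distinctColours-count (λ l → a l ∧ not (b l)) col s
    λ l l' l<l' l'<s at-l at-l' → distinct l l' l<l' l'<s
      (proj₁ (∧not-true (a l) (b l) at-l)) (proj₂ (∧not-true (a l) (b l) at-l))
      (proj₁ (∧not-true (a l') (b l') at-l')) (proj₂ (∧not-true (a l') (b l') at-l'))))
  where
  ∧not-true : ∀ x y → x ∧ not y ≡ true → x ≡ true × y ≡ false
  ∧not-true true false _ = refl , refl

data Chain : Set where
  A B C : Chain

Below : Chain → ℕ → Chain → ℕ → Set
Below A i A i' = i ≤ i'
Below A i B j  = i ≤ j
Below A i C l  = i ≤ suc (2 * l)
Below B j B j' = j ≤ j'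
Below B j C l  = j ≤ l
Below C l C l' = l ≤ l'
Below _ _ _ _  = ⊥

Below? : ∀ X p Y q → Dec (Below X p Y q)
Below? A i A i' = i ≤? i'
Below? A i B j  = i ≤? j
Below? A i C l  = i ≤? suc (2 * l)
Below? B _ A _  = no λ ()
Below? B j B j' = j ≤? j'
Below? B j C l  = j ≤? l
Below? C _ A _  = no λ ()
Below? C _ B _  = no λ ()
Below? C l C l' = l ≤? l'

Below-refl : ∀ X p → Below X p X p
Below-refl A p = ≤-refl
Below-refl B p = ≤-refl
Below-refl C p = ≤-refl

Below-trans : ∀ X p Y q Z r → Below X p Y q → Below Y q Z r → Below X p Z r
Below-trans A p A q A r a b = ≤-trans a b
Below-trans A p A q B r a b = ≤-trans a b
Below-trans A p A q C r a b = ≤-trans a b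
Below-trans A p B q B r a b = ≤-trans a b
Below-trans A p B q C r a b = ≤-trans a (≤-trans b (≤-trans (m≤m+n r (r + 0)) (n≤1+n _)))
Below-trans A p C q C r a b = ≤-trans a (s≤s (*-monoʳ-≤ 2 b))
Below-trans B p B q B r a b = ≤-trans a b
Below-trans B p B q C r a b = ≤-trans a b
Below-trans B p C q C r a b = ≤-trans a b
Below-trans C p C q C r a b = ≤-trans a b
Below-trans A p B q A r _ ()
Below-trans A p C q A r _ ()
Below-trans A p C q B r _ ()
Below-trans B p B q A r _ ()
Below-trans B p C q A r _ ()
Below-trans B p C q B r _ ()
Below-trans C p C q A r _ ()
Below-trans C p C q B r _ ()
Below-trans B p A q Z r () _
Below-trans C p A q Z r () _
Below-trans C p B q Z r () _

Below-antisym : ∀ X p Y q → Below X p Y q → Below Y q X p → X ≡ Y × p ≡ q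
Below-antisym A p A q a b = refl , ≤-antisym a b
Below-antisym B p B q a b = refl , ≤-antisym a b
Below-antisym C p C q a b = refl , ≤-antisym a b
Below-antisym A p B q _ ()
Below-antisym A p C q _ ()
Below-antisym B p C q _ ()
Below-antisym B p A q () _
Below-antisym C p A q () _
Below-antisym C p B q () _

Below-total : ∀ X p q → Below X p X q ⊎ Below X q X p
Below-total A p q = ≤-total p q
Below-total B p q = ≤-total p q
Below-total C p q = ≤-total p q

chainIndex : Chain → Fin 3
chainIndex A = zero
chainIndex B = suc zero
chainIndex C = suc (suc zero)

chainIndex-injective : ∀ X Y → chainIndex X ≡ chainIndex Y → X ≡ Y
chainIndex-injective A A _ = refl
chainIndex-injective B B _ = refl
chainIndex-injective C C _ = refl

module ThreeChains (N : ℕ) where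

  Elem : Set
  Elem = Fin (N + (N + N))

  elem : Chain → Fin N → Elem
  elem A i = i ↑ˡ (N + N)
  elem B i = N ↑ʳ (i ↑ˡ N)
  elem C i = N ↑ʳ (N ↑ʳ i)

  decodeBC : Fin N ⊎ Fin N → Chain × Fin N
  decodeBC (inj₁ j) = B , j
  decodeBC (inj₂ l) = C , l

  decode : Elem → Chain × Fin N
  decode x = [ (λ i → A , i) , (λ y → decodeBC (splitAt N y)) ]′ (splitAt N x)

  decode-elem : ∀ X i → decode (elem X i) ≡ (X , i)
  decode-elem A i rewrite splitAt-↑ˡ N i (N + N) = refl
  decode-elem B i rewrite splitAt-↑ʳ N (N + N) (i ↑ˡ N) | splitAt-↑ˡ N i N = refl
  decode-elem C i rewrite splitAt-↑ʳ N (N + N) (N ↑ʳ i) | splitAt-↑ʳ N N i = refl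

  elem-decode : ∀ x → elem (proj₁ (decode x)) (proj₂ (decode x)) ≡ x
  elem-decode x with splitAt N x in split₁
  ... | inj₁ _ = splitAt⁻¹-↑ˡ split₁
  ... | inj₂ y with splitAt N y in split₂
  ...   | inj₁ _ = trans (cong (N ↑ʳ_) (splitAt⁻¹-↑ˡ split₂)) (splitAt⁻¹-↑ʳ split₁)
  ...   | inj₂ _ = trans (cong (N ↑ʳ_) (splitAt⁻¹-↑ʳ split₂)) (splitAt⁻¹-↑ʳ split₁)

  chain : Elem → Chain
  chain x = proj₁ (decode x)

  pos : Elem → ℕ
  pos x = toℕ (proj₂ (decode x))

  decode-injective : ∀ x y → chain x ≡ chain y → pos x ≡ pos y → x ≡ y
  decode-injective x y sameChain samePos =
    trans (sym (elem-decode x)) (trans (cong₂ elem sameChain (toℕ-injective samePos)) (elem-decode y))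

  _⊑_ : Elem → Elem → Set
  x ⊑ y = Below (chain x) (pos x) (chain y) (pos y)

  ⊑-isPartialOrder : IsPartialOrder _≡_ _⊑_
  ⊑-isPartialOrder = record
    { isPreorder = record
      { isEquivalence = isEquivalence
      ; reflexive     = λ { {x} refl → Below-refl (chain x) (pos x) }
      ; trans         = λ {x} {y} {z} → Below-trans (chain x) (pos x) (chain y) (pos y) (chain z) (pos z) }
    ; antisym = λ {x} {y} x⊑y y⊑x →
        let sameChain , samePos = Below-antisym (chain x) (pos x) (chain y) (pos y) x⊑y y⊑x
        in  decode-injective x y sameChain samePos }

  P : FinPoset
  P = record { size = N + (N + N) ; _≼_ = _⊑_ ; isPartialOrder = ⊑-isPartialOrder
             ; decide = λ x y → Below? (chain x) (pos x) (chain y) (pos y) }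

  width≤3 : WidthAtMost 3 P
  width≤3 = chainCover-width P 3 (λ x → chainIndex (chain x)) sameChain-comparable
    where
    sameChain-comparable : ∀ x y → chainIndex (chain x) ≡ chainIndex (chain y) → x ⊑ y ⊎ y ⊑ x
    sameChain-comparable x y same
      rewrite chainIndex-injective (chain x) (chain y) same = Below-total (chain y) (pos x) (pos y)

-- Clamping a natural number into Fin (suc M); exact below suc M.
clamp : ∀ M → ℕ → Fin (suc M)
clamp zero    _       = zero
clamp (suc M) zero    = zero
clamp (suc M) (suc l) = suc (clamp M l)

toℕ-clamp : ∀ M l → l ≤ M → toℕ (clamp M l) ≡ l
toℕ-clamp zero    zero    _         = refl
toℕ-clamp (suc M) zero    _         = refl
toℕ-clamp (suc M) (suc l) (s≤s l≤M) = cong suc (toℕ-clamp M l l≤M)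

sum-clamp : ∀ M (f : Fin (suc M) → Bool) → sum (λ i → ind (f i)) ≡ count (λ l → f (clamp M l)) (suc M)
sum-clamp zero    f = +-comm (ind (f zero)) 0
sum-clamp (suc M) f = trans (cong (ind (f zero) +_) (sum-clamp M (λ i → f (suc i))))
                            (sym (count-shift (λ l → f (clamp (suc M) l)) 1 (suc M)))

isC : Chain → Bool
isC C = true
isC _ = false

-- Comparing two chains,
-- the positions where one is inside and the other outside are separated by
-- colours, so the counts differ by at most k; these comparisons give the
-- doubling inequalities for the chain C.
module CutCounts (M k : ℕ) where
  N : ℕ
  N = suc M
  open ThreeChains N public

  at : Chain → ℕ → Elem
  at X l = elem X (clamp M l)

  chain-at : ∀ X l → chain (at X l) ≡ X
  chain-at X l = cong proj₁ (decode-elem X (clamp M l))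

  pos-at : ∀ X l → l < N → pos (at X l) ≡ l
  pos-at X l (s≤s l≤M) = trans (cong (λ p → toℕ (proj₂ p)) (decode-elem X (clamp M l))) (toℕ-clamp M l l≤M)

  ⊑-at : ∀ X Y l l' → l < N → l' < N → Below X l Y l' → at X l ⊑ at Y l'
  ⊑-at X Y l l' l<N l'<N = subst₂ (λ Z p → Below Z p (chain (at Y l')) (pos (at Y l')))
                             (sym (chain-at X l)) (sym (pos-at X l l<N))
                         ∘′ subst₂ (Below X l) (sym (chain-at Y l')) (sym (pos-at Y l' l'<N))

  ⋢-at : ∀ X Y l l' → l < N → l' < N → ¬ Below X l Y l' → ¬ at X l ⊑ at Y l'
  ⋢-at X Y l l' l<N l'<N ¬below = ¬below ∘′ subst₂ (λ Z p → Below Z p Y l') (chain-at X l) (pos-at X l l<N)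
                                        ∘′ subst₂ (Below (chain (at X l)) (pos (at X l))) (chain-at Y l') (pos-at Y l' l'<N)

  arc-at : ∀ X Y l l' → l < N → l' < N → (X , l) ≢ (Y , l') → Below X l Y l' → PosetArc P (at X l) (at Y l')
  arc-at X Y l l' l<N l'<N distinct below = ⊑-at X Y l l' l<N l'<N below , λ same →
    distinct (cong₂ _,_ (trans (sym (chain-at X l)) (trans (cong chain same) (chain-at Y l')))
                        (trans (sym (pos-at X l l<N)) (trans (cong pos same) (pos-at Y l' l'<N))))

  noArc-at : ∀ X Y l l' → l < N → l' < N → ¬ Below X l Y l' → ¬ PosetArc P (at X l) (at Y l')
  noArc-at X Y l l' l<N l'<N ¬below (x⊑y , _) = ⋢-at X Y l l' l<N l'<N ¬below x⊑y

  onC : Elem → ℕ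
  onC x = ind (isC (chain x))

  onC≤1 : ∀ x → onC x ≤ 1
  onC≤1 x = ind≤1 (isC (chain x))

  weight-onC : (S : Elem → Bool) → weightIn S onC ≡ count (λ l → S (at C l)) N
  weight-onC S = begin
    weightIn S onC
      ≡⟨ sum-↑ N (N + N) on′ ⟩
    sum (λ i → on A i) + sum (λ j → on′ (N ↑ʳ j))
      ≡⟨ cong (sum (λ i → on A i) +_) (sum-↑ N N (λ j → on′ (N ↑ʳ j))) ⟩
    sum (λ i → on A i) + (sum (λ i → on B i) + sum (λ i → on C i))
      ≡⟨ cong₂ (λ a b → a + (b + sum (λ i → on C i))) (noWeight A (λ ())) (noWeight B (λ ())) ⟩
    sum (λ i → on C i)
      ≡⟨ sum-cong-≗ (λ i → trans (onElem C i) (indicator (S (elem C i)))) ⟩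
    sum (λ i → ind (S (elem C i)))
      ≡⟨ sum-clamp M (λ i → S (elem C i)) ⟩
    count (λ l → S (at C l)) N ∎
    where
    open ≡-Reasoning
    on′ : Elem → ℕ
    on′ x = if S x then onC x else 0
    on : Chain → Fin N → ℕ
    on X i = on′ (elem X i)
    onElem : ∀ X i → on X i ≡ (if S (elem X i) then ind (isC X) else 0)
    onElem X i = cong (λ d → if S (elem X i) then ind (isC (proj₁ d)) else 0) (decode-elem X i)
    indicator : ∀ b → (if b then 1 else 0) ≡ ind b
    indicator true  = refl
    indicator false = refl
    zero-either-way : ∀ b → (if b then 0 else 0) ≡ 0
    zero-either-way true  = refl
    zero-either-way false = refl
    noWeight : ∀ X → X ≢ C → sum (λ i → on X i) ≡ 0
    noWeight X X≢C =
      trans (sum-cong-≗ λ i → trans (onElem X i) (cong (λ b → if S (elem X i) then ind b else 0) (notC X X≢C)))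
            (trans (sum-cong-≗ λ i → zero-either-way (S (elem X i))) (sum-replicate-zero N))
      where
      notC : ∀ X → X ≢ C → isC X ≡ false
      notC A _ = refl
      notC B _ = refl
      notC C C≢C = ⊥-elim (C≢C refl)

  module Counting (S : TwinCut k (PosetArc P)) where

    inAt : Chain → ℕ → Bool
    inAt X l = inside S (at X l)

    F : Chain → ℕ → ℕ
    F X = count (inAt X)

    separatedOut : ∀ x y z → inside S x ≡ true → inside S y ≡ true → inside S z ≡ false →
                   PosetArc P x z → ¬ PosetArc P y z → colour S x ≢ colour S y
    separatedOut x y z sx sy sz xz ¬yz same = ¬yz (twinOut S x y z sx sy same sz xz)

    separatedIn : ∀ x y z → inside S x ≡ true → inside S y ≡ true → inside S z ≡ false →
                  PosetArc P z x → ¬ PosetArc P z y → colour S x ≢ colour S y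
    separatedIn x y z sx sy sz zx ¬zy same = ¬zy (twinIn S x y z sx sy same sz zx)

    -- Comparing chain X at positions pa with chain Y at positions pb, when
    -- X_(pa l) ≤ Y_(pb l) but X_(pa l') ≰ Y_(pb l) for l < l': the outside
    -- element Y_(pb l) separates X_(pa l) from X_(pa l').
    compareOut : ∀ X Y (pa pb : ℕ → ℕ) t → X ≢ Y → (∀ l → l < t → pa l < N × pb l < N) →
      (∀ l → Below X (pa l) Y (pb l)) → (∀ l l' → l < l' → ¬ Below X (pa l') Y (pb l)) →
      count (λ l → inAt X (pa l)) t ≤ count (λ l → inAt Y (pb l)) t + k
    compareOut X Y pa pb t X≢Y range below notBelow =
      count-transfer _ _ (λ l → colour S (at X (pa l))) t
        λ l l' l<l' l'<t xl yl xl' _ → separatedOut (at X (pa l)) (at X (pa l')) (at Y (pb l)) xl xl' yl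
          (arc-at X Y (pa l) (pb l) (proj₁ (range l (<-trans l<l' l'<t))) (proj₂ (range l (<-trans l<l' l'<t)))
                  (X≢Y ∘′ cong proj₁) (below l))
          (noArc-at X Y (pa l') (pb l) (proj₁ (range l' l'<t)) (proj₂ (range l (<-trans l<l' l'<t)))
                  (notBelow l l' l<l'))

    compareIn : ∀ X Y (pa pb : ℕ → ℕ) t → X ≢ Y → (∀ l → l < t → pa l < N × pb l < N) →
      (∀ l → Below Y (pb l) X (pa l)) → (∀ l l' → l < l' → ¬ Below Y (pb l') X (pa l)) →
      count (λ l → inAt X (pa l)) t ≤ count (λ l → inAt Y (pb l)) t + k
    compareIn X Y pa pb t X≢Y range below notBelow =
      count-transfer _ _ (λ l → colour S (at X (pa l))) t
        λ l l' l<l' l'<t xl _ xl' yl' same → separatedIn (at X (pa l')) (at X (pa l)) (at Y (pb l')) xl' xl yl'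
          (arc-at Y X (pb l') (pa l') (proj₂ (range l' l'<t)) (proj₁ (range l' l'<t))
                  (X≢Y ∘′ sym ∘′ cong proj₁) (below l'))
          (noArc-at Y X (pb l') (pa l) (proj₂ (range l' l'<t)) (proj₁ (range l (<-trans l<l' l'<t)))
                  (notBelow l l' l<l'))
            (sym same)

    even : ℕ → ℕ
    even l = 2 * l

    odd : ℕ → ℕ
    odd l = suc (2 * l)

    A≤B : ∀ l → Below A l B l
    A≤B l = ≤-refl

    A≰B : ∀ l l' → l < l' → ¬ Below A l' B l
    A≰B l l' l<l' = <⇒≱ l<l'

    B≤C : ∀ l → Below B l C l
    B≤C l = ≤-refl

    B≰C : ∀ l l' → l < l' → ¬ Below B l' C l
    B≰C l l' l<l' = <⇒≱ l<l'

    Aeven≤C : ∀ l → Below A (even l) C l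
    Aeven≤C l = n≤1+n _

    Aodd≤C : ∀ l → Below A (odd l) C l
    Aodd≤C l = ≤-refl

    odd< : ∀ l l' → l < l' → odd l < even l'
    odd< l l' l<l' = ≤-trans (≤-reflexive (sym (*-suc 2 l))) (*-monoʳ-≤ 2 l<l')

    Aeven≰C : ∀ l l' → l < l' → ¬ Below A (even l') C l
    Aeven≰C l l' l<l' = <⇒≱ (odd< l l' l<l')

    Aodd≰C : ∀ l l' → l < l' → ¬ Below A (odd l') C l
    Aodd≰C l l' l<l' = <⇒≱ (m<n⇒m<1+n (odd< l l' l<l'))

    range-id : ∀ t → t ≤ N → ∀ l → l < t → l < N × l < N
    range-id t t≤N l l<t = <-≤-trans l<t t≤N , <-≤-trans l<t t≤N

    odd-range : ∀ t → 2 * t ≤ N → ∀ l → l < t → odd l < N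
    odd-range t 2t≤N l l<t = <-≤-trans (≤-trans (≤-reflexive (sym (*-suc 2 l))) (*-monoʳ-≤ 2 l<t)) 2t≤N

    id-range : ∀ t → 2 * t ≤ N → ∀ l → l < t → l < N
    id-range t 2t≤N l l<t = <-≤-trans l<t (≤-trans (m≤m+n t (t + 0)) 2t≤N)

    range-even : ∀ t → 2 * t ≤ N → ∀ l → l < t → even l < N × l < N
    range-even t 2t≤N l l<t = <-trans (n<1+n _) (odd-range t 2t≤N l l<t) , id-range t 2t≤N l l<t

    range-odd : ∀ t → 2 * t ≤ N → ∀ l → l < t → odd l < N × l < N
    range-odd t 2t≤N l l<t = odd-range t 2t≤N l l<t , id-range t 2t≤N l l<t

    swap-range : ∀ {t} {pa pb : ℕ → ℕ} → (∀ l → l < t → pa l < N × pb l < N) →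
                 ∀ l → l < t → pb l < N × pa l < N
    swap-range range l l<t = proj₂ (range l l<t) , proj₁ (range l l<t)

    FAeven FAodd : ℕ → ℕ
    FAeven = count (λ l → inAt A (even l))
    FAodd  = count (λ l → inAt A (odd l))

    FA-double : ∀ t → F A (2 * t) ≡ FAeven t + FAodd t
    FA-double t = count-even-odd (inAt A) t

    doubling-upper : ∀ t → 2 * t ≤ N → F C (2 * t) ≤ 2 * F C t + 4 * k
    doubling-upper t 2t≤N = begin
      F C (2 * t)                             ≤⟨ compareIn C B id id (2 * t) (λ ()) (range-id _ 2t≤N) B≤C B≰C ⟩
      F B (2 * t) + k                         ≤⟨ +-monoˡ-≤ k (compareIn B A id id (2 * t) (λ ()) (range-id _ 2t≤N) A≤B A≰B) ⟩
      F A (2 * t) + k + k                     ≡⟨ cong (λ v → v + k + k) (FA-double t) ⟩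
      FAeven t + FAodd t + k + k              ≤⟨ +-monoˡ-≤ k (+-monoˡ-≤ k (+-mono-≤
                                                   (compareOut A C even id t (λ ()) (range-even t 2t≤N) Aeven≤C Aeven≰C)
                                                   (compareOut A C odd id t (λ ()) (range-odd t 2t≤N) Aodd≤C Aodd≰C))) ⟩
      (F C t + k) + (F C t + k) + k + k       ≡⟨ solve 2 (λ f k → f :+ k :+ (f :+ k) :+ k :+ k := con 2 :* f :+ con 4 :* k)
                                                   refl (F C t) k ⟩
      2 * F C t + 4 * k                       ∎
      where open ≤-Reasoning
            open +-*-Solver

    doubling-lower : ∀ t → 2 * t ≤ N → 2 * F C t ≤ F C (2 * t) + 4 * k
    doubling-lower t 2t≤N = begin
      2 * F C t                               ≡⟨ cong (F C t +_) (+-identityʳ (F C t)) ⟩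
      F C t + F C t                           ≤⟨ +-mono-≤
                                                   (compareIn C A id even t (λ ()) (swap-range (range-even t 2t≤N)) Aeven≤C Aeven≰C)
                                                   (compareIn C A id odd t (λ ()) (swap-range (range-odd t 2t≤N)) Aodd≤C Aodd≰C) ⟩
      FAeven t + k + (FAodd t + k)            ≡⟨ solve 3 (λ a b k → a :+ k :+ (b :+ k) := a :+ b :+ k :+ k) refl (FAeven t) (FAodd t) k ⟩
      FAeven t + FAodd t + k + k              ≡⟨ cong (λ v → v + k + k) (sym (FA-double t)) ⟩
      F A (2 * t) + k + k                     ≤⟨ +-monoˡ-≤ k (+-monoˡ-≤ k (compareOut A B id id (2 * t) (λ ()) (range-id _ 2t≤N) A≤B A≰B)) ⟩
      F B (2 * t) + k + k + k                 ≤⟨ +-monoˡ-≤ k (+-monoˡ-≤ k (+-monoˡ-≤ k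
                                                   (compareOut B C id id (2 * t) (λ ()) (range-id _ 2t≤N) B≤C B≰C))) ⟩
      F C (2 * t) + k + k + k + k             ≡⟨ solve 2 (λ f k → f :+ k :+ k :+ k :+ k := f :+ con 4 :* k) refl (F C (2 * t)) k ⟩
      F C (2 * t) + 4 * k                     ∎
      where open ≤-Reasoning
            open +-*-Solver

    -- Alternation along C: k + 1 inside elements C_(p u) with an outside element
    -- C_q between any two of them would need k + 1 colours, since C_q lies
    -- above the earlier but not above the later one.
    alternation : (p : Fin (suc k) → ℕ) → (∀ u → p u < N) → (∀ u → inAt C (p u) ≡ true) →
      (∀ u u' → u <ᶠ u' → ∃ λ q → q < N × inAt C q ≡ false × p u < q × q < p u') → ⊥
    alternation p p<N inside-p between = colours-collide k (λ u → colour S (at C (p u))) separated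
      where
      separated : ∀ u u' → u <ᶠ u' → colour S (at C (p u)) ≢ colour S (at C (p u'))
      separated u u' u<u' with between u u' u<u'
      ... | q , q<N , outside-q , p<q , q<p′ =
        separatedOut (at C (p u)) (at C (p u')) (at C q) (inside-p u) (inside-p u') outside-q
          (arc-at C C (p u) q (p<N u) q<N (λ same → <⇒≢ p<q (cong proj₂ same)) (<⇒≤ p<q))
          (noArc-at C C (p u') q (p<N u') q<N (<⇒≱ q<p′))

climb : ∀ (R : ℕ → ℕ → Set) bound → (∀ j H → j < bound → R j H → R (suc j) (2 * H)) →
        ∀ d j H → j + d ≤ bound → R j H → R (j + d) (2 ^ d * H)
climb R bound step zero j H _ r rewrite +-identityʳ j | *-identityˡ H = r
climb R bound step (suc d) j H j+d<bound r rewrite +-suc j d | *-assoc 2 (2 ^ d) H =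
  step (j + d) (2 ^ d * H) j+d<bound (climb R bound step d j H (≤-trans (n≤1+n _) j+d<bound) r)

twice-below : ∀ P k g → 1 ≤ P → g ≤ P * (8 * k) + 1 → 2 * g ≤ P * (16 * suc k)
twice-below P k g 1≤P g≤ = begin
  2 * g                   ≤⟨ *-monoʳ-≤ 2 g≤ ⟩
  2 * (P * (8 * k) + 1)   ≡⟨ solve 2 (λ P k → con 2 :* (P :* (con 8 :* k) :+ con 1) := P :* (con 16 :* k) :+ con 2)
                               refl P k ⟩
  P * (16 * k) + 2        ≤⟨ +-monoʳ-≤ (P * (16 * k)) (≤-trans (s≤s (s≤s z≤n)) (*-monoˡ-≤ 16 1≤P)) ⟩
  P * (16 * k) + P * 16   ≡⟨ solve 2 (λ P k → P :* (con 16 :* k) :+ P :* con 16 := P :* (con 16 :* (con 1 :+ k)))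
                               refl P k ⟩
  P * (16 * suc k)        ∎
  where open ≤-Reasoning
        open +-*-Solver

half-below : ∀ P k → 1 ≤ P → P * (8 * k) < P * (16 * suc k)
half-below P k 1≤P = begin-strict
  P * (8 * k)             <⟨ m<m+n (P * (8 * k)) (≤-trans (s≤s z≤n) (*-monoˡ-≤ 16 1≤P)) ⟩
  P * (8 * k) + P * 16    ≤⟨ +-monoˡ-≤ (P * 16) (*-monoʳ-≤ P (*-monoˡ-≤ k (m≤m+n 8 8))) ⟩
  P * (16 * k) + P * 16   ≡⟨ solve 2 (λ P k → P :* (con 16 :* k) :+ P :* con 16 := P :* (con 16 :* (con 1 :+ k)))
                               refl P k ⟩
  P * (16 * suc k)        ∎
  where open ≤-Reasoning
        open +-*-Solver

module Scales (k : ℕ) where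

  t : ℕ → ℕ
  t i = 2 ^ i * (16 * suc k)

  T : ℕ
  T = t (2 * k)

  open CutCounts (2 * T) k public

  t-suc : ∀ i → t (suc i) ≡ 2 * t i
  t-suc i = *-assoc 2 (2 ^ i) (16 * suc k)

  t-mono : ∀ {i j} → i ≤ j → t i ≤ t j
  t-mono i≤j = *-monoˡ-≤ (16 * suc k) (^-monoʳ-≤ 2 i≤j)

  t-last : t (suc (2 * k)) ≡ 2 * T
  t-last = t-suc (2 * k)

  2t≤N : ∀ {i} → i ≤ 2 * k → 2 * t i ≤ N
  2t≤N {i} i≤2k = begin
    2 * t i          ≡⟨ sym (t-suc i) ⟩
    t (suc i)        ≤⟨ t-mono (s≤s i≤2k) ⟩
    t (suc (2 * k))  ≡⟨ t-last ⟩
    2 * T            ≤⟨ n≤1+n _ ⟩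
    N                ∎
    where open ≤-Reasoning

  1≤T : 1 ≤ T
  1≤T = *-mono-≤ (m^n>0 2 (2 * k)) (s≤s z≤n)

  T<total : T < sum onC
  T<total = subst (T <_) (sym (trans (weight-onC (λ _ → true)) (count-true N))) (s≤s (m≤m+n T (T + 0)))

  module _ (S : TwinCut k (PosetArc P)) where
    open Counting S

    G : ℕ → ℕ
    G = F C

    window : ℕ → ℕ
    window i = count (λ u → inAt C (t i + u)) (t i)

    G-split : ∀ i → G (2 * t i) ≡ G (t i) + window i
    G-split i = trans (cong G (cong (t i +_) (+-identityʳ (t i)))) (count-shift (inAt C) (t i) (t i))

    Homogeneous : ℕ → Set
    Homogeneous i = window i ≡ 0 ⊎ window i ≡ t i

    homogeneous? : ∀ i → Dec (Homogeneous i)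
    homogeneous? i with window i ≟ 0 | window i ≟ t i
    ... | yes allOut | _         = yes (inj₁ allOut)
    ... | no _       | yes allIn = yes (inj₂ allIn)
    ... | no ¬allOut | no ¬allIn = no λ { (inj₁ allOut) → ¬allOut allOut ; (inj₂ allIn) → ¬allIn allIn }

    InWindow : ℕ → ℕ → Set
    InWindow i p = t i ≤ p × p < 2 * t i

    inWindow : ∀ i u → u < t i → InWindow i (t i + u)
    inWindow i u u<t = m≤m+n (t i) u , subst (t i + u <_) (cong (t i +_) (sym (+-identityʳ (t i)))) (+-monoʳ-< (t i) u<t)

    insideIn : ∀ i → window i ≢ 0 → ∃ λ p → InWindow i p × inAt C p ≡ true
    insideIn i nonempty with some-true (λ u → inAt C (t i + u)) (t i) (n≢0⇒n>0 nonempty)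
    ... | u , u<t , inside-u = t i + u , inWindow i u u<t , inside-u

    outsideIn : ∀ i → window i ≢ t i → ∃ λ p → InWindow i p × inAt C p ≡ false
    outsideIn i nonfull with some-false (λ u → inAt C (t i + u)) (t i)
                               (≤∧≢⇒< (count≤ (λ u → inAt C (t i + u)) (t i)) nonfull)
    ... | u , u<t , outside-u = t i + u , inWindow i u u<t , outside-u

    -- Some window with i ≤ 2k is homogeneous.  Otherwise the inside elements of
    -- the windows 2u (u ≤ k), separated by outside elements of the windows
    -- 2u + 1, would form an alternation.
    homogeneousWindow : ∃ λ i → i ≤ 2 * k × Homogeneous i
    homogeneousWindow with anyUpTo? homogeneous? (suc (2 * k))
    ... | yes (i , s≤s i≤2k , hom) = i , i≤2k , hom
    ... | no none = ⊥-elim (alternation p p<N inside-p between)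
      where
      inhomogeneous : ∀ i → i ≤ 2 * k → ¬ Homogeneous i
      inhomogeneous i i≤2k hom = none (i , s≤s i≤2k , hom)

      even≤ : (u : Fin (suc k)) → 2 * toℕ u ≤ 2 * k
      even≤ u = *-monoʳ-≤ 2 (≤-pred (toℕ<n u))

      twoApart : ∀ {u u'} → u <ᶠ u' → suc (suc (2 * toℕ u)) ≤ 2 * toℕ u'
      twoApart {u} u<u' = ≤-trans (≤-reflexive (sym (*-suc 2 (toℕ u)))) (*-monoʳ-≤ 2 u<u')

      pick : (u : Fin (suc k)) → ∃ λ p → InWindow (2 * toℕ u) p × inAt C p ≡ true
      pick u = insideIn (2 * toℕ u) (λ allOut → inhomogeneous _ (even≤ u) (inj₁ allOut))

      p : Fin (suc k) → ℕ
      p u = proj₁ (pick u)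

      p<N : ∀ u → p u < N
      p<N u = <-≤-trans (proj₂ (proj₁ (proj₂ (pick u)))) (2t≤N (even≤ u))

      inside-p : ∀ u → inAt C (p u) ≡ true
      inside-p u = proj₂ (proj₂ (pick u))

      odd≤ : ∀ {u u'} → u <ᶠ u' → suc (2 * toℕ u) ≤ 2 * k
      odd≤ {u' = u'} u<u' = ≤-trans (n≤1+n _) (≤-trans (twoApart u<u') (even≤ u'))

      between : ∀ u u' → u <ᶠ u' → ∃ λ q → q < N × inAt C q ≡ false × p u < q × q < p u'
      between u u' u<u' with outsideIn (suc (2 * toℕ u)) (λ allIn → inhomogeneous _ (odd≤ u<u') (inj₂ allIn))
      ... | q , (t≤q , q<2t) , outside-q =
        q , <-≤-trans q<2t (2t≤N (odd≤ u<u'))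
          , outside-q
          , <-≤-trans (proj₂ (proj₁ (proj₂ (pick u)))) (≤-trans (≤-reflexive (sym (t-suc (2 * toℕ u)))) t≤q)
          , <-≤-trans q<2t (≤-trans (≤-reflexive (sym (t-suc (suc (2 * toℕ u)))))
                             (≤-trans (t-mono (twoApart u<u')) (proj₁ (proj₁ (proj₂ (pick u'))))))

    -- Low j H: the count at scale j is small, G (t j) + 4k ≤ H.
    -- By the upper doubling bound this survives a doubling of the scale.
    Low : ℕ → ℕ → Set
    Low j H = G (t j) + 4 * k ≤ H

    low-step : ∀ j H → j < suc (2 * k) → Low j H → Low (suc j) (2 * H)
    low-step j H (s≤s j≤2k) low = begin
      G (t (suc j)) + 4 * k         ≡⟨ cong (λ s → G s + 4 * k) (t-suc j) ⟩
      G (2 * t j) + 4 * k           ≤⟨ +-monoˡ-≤ (4 * k) (doubling-upper (t j) (2t≤N j≤2k)) ⟩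
      2 * G (t j) + 4 * k + 4 * k   ≡⟨ solve 2 (λ g k → con 2 :* g :+ con 4 :* k :+ con 4 :* k := con 2 :* (g :+ con 4 :* k))
                                          refl (G (t j)) k ⟩
      2 * (G (t j) + 4 * k)         ≤⟨ *-monoʳ-≤ 2 low ⟩
      2 * H                         ∎
      where open ≤-Reasoning
            open +-*-Solver

    -- High j H: the count at scale j is large, t j + 4k ≤ G (t j) + H.
    -- By the lower doubling bound this survives a doubling of the scale.
    High : ℕ → ℕ → Set
    High j H = t j + 4 * k ≤ G (t j) + H

    high-step : ∀ j H → j < suc (2 * k) → High j H → High (suc j) (2 * H)
    high-step j H (s≤s j≤2k) high = +-cancelʳ-≤ (4 * k) _ _ (begin
      t (suc j) + 4 * k + 4 * k         ≡⟨ cong (λ s → s + 4 * k + 4 * k) (t-suc j) ⟩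
      2 * t j + 4 * k + 4 * k           ≡⟨ solve 2 (λ x k → con 2 :* x :+ con 4 :* k :+ con 4 :* k := con 2 :* (x :+ con 4 :* k))
                                              refl (t j) k ⟩
      2 * (t j + 4 * k)                 ≤⟨ *-monoʳ-≤ 2 high ⟩
      2 * (G (t j) + H)                 ≡⟨ *-distribˡ-+ 2 (G (t j)) H ⟩
      2 * G (t j) + 2 * H               ≤⟨ +-monoˡ-≤ (2 * H) (doubling-lower (t j) (2t≤N j≤2k)) ⟩
      G (2 * t j) + 4 * k + 2 * H       ≡⟨ solve 3 (λ g k h → g :+ con 4 :* k :+ h := g :+ h :+ con 4 :* k)
                                              refl (G (2 * t j)) k (2 * H) ⟩
      G (2 * t j) + 2 * H + 4 * k       ≡⟨ cong (λ s → G s + 2 * H + 4 * k) (sym (t-suc j)) ⟩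
      G (t (suc j)) + 2 * H + 4 * k     ∎)
      where open ≤-Reasoning
            open +-*-Solver

    climbToTop : ∀ (R : ℕ → ℕ → Set) → (∀ j H → j < suc (2 * k) → R j H → R (suc j) (2 * H)) →
      (∀ j {H H'} → H ≤ H' → R j H → R j H') →
      ∀ i H → i ≤ 2 * k → R (suc i) H → R (suc (2 * k)) (2 ^ (2 * k) * H)
    climbToTop R step weaken i H i≤2k r with m≤n⇒∃[o]m+o≡n i≤2k
    ... | d , i+d≡2k = weaken (suc (2 * k)) (*-monoˡ-≤ H (^-monoʳ-≤ 2 d≤2k))
          (subst (λ j → R (suc j) (2 ^ d * H)) i+d≡2k
            (climb R (suc (2 * k)) step d (suc i) H (s≤s (≤-reflexive i+d≡2k)) r))
      where
      d≤2k : d ≤ 2 * k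
      d≤2k = ≤-trans (m≤n+m d i) (≤-reflexive i+d≡2k)

    -- An entirely outside window at scale i ≤ 2k starts a Low climb at scale suc i:
    -- by the lower doubling bound G (t i) ≤ 4k, and G does not grow on the window.
    allOut-low : ∀ i → i ≤ 2 * k → window i ≡ 0 → Low (suc i) (8 * k)
    allOut-low i i≤2k allOut = begin
      G (t (suc i)) + 4 * k     ≡⟨ cong (λ s → G s + 4 * k) (t-suc i) ⟩
      G (2 * t i) + 4 * k       ≡⟨ cong (_+ 4 * k) flat ⟩
      G (t i) + 4 * k           ≤⟨ +-monoˡ-≤ (4 * k) small ⟩
      4 * k + 4 * k             ≡⟨ solve 1 (λ k → con 4 :* k :+ con 4 :* k := con 8 :* k) refl k ⟩
      8 * k                     ∎
      where
      open ≤-Reasoning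
      open +-*-Solver
      flat : G (2 * t i) ≡ G (t i)
      flat = trans (G-split i) (trans (cong (G (t i) +_) allOut) (+-identityʳ _))
      small : G (t i) ≤ 4 * k
      small = +-cancelˡ-≤ (G (t i)) _ _ (begin
        G (t i) + G (t i)       ≡⟨ cong (G (t i) +_) (sym (+-identityʳ (G (t i)))) ⟩
        2 * G (t i)             ≤⟨ doubling-lower (t i) (2t≤N i≤2k) ⟩
        G (2 * t i) + 4 * k     ≡⟨ cong (_+ 4 * k) flat ⟩
        G (t i) + 4 * k         ∎)

    -- An entirely inside window at scale i ≤ 2k starts a High climb at scale suc i:
    -- by the upper doubling bound t i ≤ G (t i) + 4k, and G grows by t i on the window.
    allIn-high : ∀ i → i ≤ 2 * k → window i ≡ t i → High (suc i) (8 * k)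
    allIn-high i i≤2k allIn = begin
      t (suc i) + 4 * k               ≡⟨ cong (_+ 4 * k) (t-suc i) ⟩
      2 * t i + 4 * k                 ≡⟨ solve 2 (λ x k → con 2 :* x :+ con 4 :* k := x :+ (x :+ con 4 :* k)) refl (t i) k ⟩
      t i + (t i + 4 * k)             ≤⟨ +-monoʳ-≤ (t i) (+-monoˡ-≤ (4 * k) large) ⟩
      t i + (G (t i) + 4 * k + 4 * k) ≡⟨ solve 3 (λ x g k → x :+ (g :+ con 4 :* k :+ con 4 :* k) := g :+ x :+ con 8 :* k)
                                            refl (t i) (G (t i)) k ⟩
      G (t i) + t i + 8 * k           ≡⟨ cong (_+ 8 * k) (sym grow) ⟩
      G (2 * t i) + 8 * k             ≡⟨ cong (λ s → G s + 8 * k) (sym (t-suc i)) ⟩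
      G (t (suc i)) + 8 * k           ∎
      where
      open ≤-Reasoning
      open +-*-Solver
      grow : G (2 * t i) ≡ G (t i) + t i
      grow = trans (G-split i) (cong (G (t i) +_) allIn)
      large : t i ≤ G (t i) + 4 * k
      large = +-cancelˡ-≤ (G (t i)) _ _ (begin
        G (t i) + t i           ≡⟨ sym grow ⟩
        G (2 * t i)             ≤⟨ doubling-upper (t i) (2t≤N i≤2k) ⟩
        2 * G (t i) + 4 * k     ≡⟨ solve 2 (λ g k → con 2 :* g :+ con 4 :* k := g :+ (g :+ con 4 :* k)) refl (G (t i)) k ⟩
        G (t i) + (G (t i) + 4 * k) ∎)

    G-last : G N ≤ G (2 * T) + 1
    G-last = +-monoʳ-≤ (G (2 * T)) (ind≤1 (inAt C (2 * T)))

    -- No twin cut of P_N holds between T/2 and T of the elements of C: a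
    -- homogeneous window forces the count at the last scale 2T to be either
    -- too small or too large.
    noBalancedCut : Balanced T (G N) → ⊥
    noBalancedCut (T<2G , G≤T) with homogeneousWindow
    ... | i , i≤2k , inj₁ allOut = <⇒≱ T<2G (twice-below P₂ k (G N) (m^n>0 2 (2 * k)) small)
      where
      P₂ : ℕ
      P₂ = 2 ^ (2 * k)
      top : G (2 * T) + 4 * k ≤ P₂ * (8 * k)
      top = subst (λ s → G s + 4 * k ≤ P₂ * (8 * k)) t-last
              (climbToTop Low low-step (λ j H≤H' low → ≤-trans low H≤H') i (8 * k) i≤2k (allOut-low i i≤2k allOut))
      small : G N ≤ P₂ * (8 * k) + 1
      small = ≤-trans G-last (+-monoˡ-≤ 1 (≤-trans (m≤m+n (G (2 * T)) (4 * k)) top))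
    ... | i , i≤2k , inj₂ allIn = <⇒≱ (half-below P₂ k (m^n>0 2 (2 * k))) T≤
      where
      P₂ : ℕ
      P₂ = 2 ^ (2 * k)
      top : 2 * T + 4 * k ≤ G (2 * T) + P₂ * (8 * k)
      top = subst (λ s → s + 4 * k ≤ G s + P₂ * (8 * k)) t-last
              (climbToTop High high-step (λ j H≤H' high → ≤-trans high (+-monoʳ-≤ _ H≤H')) i (8 * k) i≤2k
                (allIn-high i i≤2k allIn))
      T≤ : T ≤ P₂ * (8 * k)
      T≤ = +-cancelˡ-≤ T _ _ (begin
        T + T                       ≡⟨ cong (T +_) (sym (+-identityʳ T)) ⟩
        2 * T                       ≤⟨ m≤m+n (2 * T) (4 * k) ⟩
        2 * T + 4 * k               ≤⟨ top ⟩
        G (2 * T) + P₂ * (8 * k)    ≤⟨ +-monoˡ-≤ (P₂ * (8 * k)) (≤-trans (m≤m+n (G (2 * T)) _) G≤T) ⟩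
        T + P₂ * (8 * k)            ∎)
        where open ≤-Reasoning

-- P_N with N = 2T + 1 and T = t (2k) has clique-width greater than k: a
-- k-expression would give a twin cut holding between T/2 and T of the
-- N elements of C.
cliqueWidth>k : ∀ k → ¬ PosetCliqueWidthAtMost k (Scales.P k)
cliqueWidth>k k cw =
  let S , balanced = cliqueWidth-balancedCut cw onC onC≤1 T 1≤T T<total
  in  noBalancedCut S (subst (Balanced T) (weight-onC (inside S)) balanced)
  where open Scales k

proposition5 : Σ Class λ 𝒫 → BoundedWidth 𝒫 × ¬ BoundedCliqueWidth 𝒫
proposition5 = 𝒫 , (3 , λ { _ (k , refl) → Scales.width≤3 k })
                 , λ { (k , bounded) → cliqueWidth>k k (bounded (Scales.P k) (k , refl)) }
  where
  𝒫 : Class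
  𝒫 Q = Σ ℕ λ k → Q ≡ Scales.P k
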